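{- Let $m>n$ be positive integers and let $\alpha=(\alpha_1,\dots,\alpha_L)$ be a composition of $n$. Let $$r=\mathrm{rr}(\alpha,m)=\min\left\{\mathrm{Iones}(\alpha)+1,\left\lceil\frac{n}{m-n}\right\rceil\right\}.$$ Then for all non-negative integers $a\le b$, $$\left|\mathcal{D}_{m,\alpha}^{(r+a,\,r+b-a)}\right|=\left|\mathcal{D}_{m,\alpha}^{(r+b,\,r)}\right|.$$
   Context: An $m\times n$ rational Dyck path is a lattice path from $(0,0)$ to $(m,n)$ using unit north steps $N$ and east steps $E$ that stays weakly above the line $y=nx/m$; $\mathcal{D}_{m,n}$ is the set of these paths. For $P\in\mathcal{D}_{m,n}$, let $(u_1,\dots,u_n)$ be its coarea sequence, where $u_i$ is the $x$-coordinate of the $i$-th north step of $P$ (bottom to top). Define $\mathrm{run}(P)=\min\{i\in\{1,\dots,n\}: i\notin\{u_1,\dots,u_n\}\}$. Let $\mathrm{ret}(P)$ be the number of north steps of $P$ from some $(i,j)$ to $(i,j+1)$ with $jm-in<n$. The composition type $\mathrm{comp}(P)$ is the composition of $n$ given by the lengths of the maximal blocks of consecutive north steps of $P$, in order. For a composition $\alpha$ of $n$, $\mathcal{D}_{m,\alpha}=\{P\in\mathcal{D}_{m,n}:\mathrm{comp}(P)=\alpha\}$ and $\mathcal{D}_{m,\alpha}^{(k,\ell)}=\{P\in\mathcal{D}_{m,\alpha}:\mathrm{run}(P)=k,\ \mathrm{ret}(P)=\ell\}$. $\mathrm{Iones}(\alpha)$ is the largest $j\ge 0$ such that $\alpha_1=\dots=\alpha_j=1$.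 -}

module Defs where

open import Data.Nat using (ℕ; zero; suc; _+_; _*_; _∸_; _<_; _≤_; _⊓_)
open import Data.Nat.Properties using (_≟_; _<?_; _≤?_)
open import Data.Nat.DivMod using (_/_)
open import Data.List using (List; []; _∷_; length; filter; map; _++_)
open import Data.Nat.ListAction using (sum)
open import Data.List.Relation.Unary.All using (All)
open import Data.Bool using (Bool; true; false; if_then_else_; _∧_)
open import Data.Bool.Properties renaming (_≟_ to _≟ᵇ_) using ()
open import Relation.Nullary.Decidable using (⌊_⌋; yes; no)
open import Relation.Binary.PropositionalEquality using (_≡_)

-- Lattice path steps: N = north (0,1), E = east (1,0).
data Step : Set where
  N E : Step

words : ℕ → ℕ → List (List Step)
words zero    zero    = [] ∷ []
words zero    (suc k) = map (N ∷_) (words zero k)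
words (suc e) zero    = map (E ∷_) (words e zero)
words (suc e) (suc k) = map (N ∷_) (words (suc e) k) ++ map (E ∷_) (words e (suc k))

-- Weakly above y = n x / m, i.e. y*m ≥ x*n, at every lattice point,
-- checked starting from current point (x , y).
aboveFrom : ℕ → ℕ → ℕ → ℕ → List Step → Bool
aboveFrom m n x y []       = ⌊ x * n ≤? y * m ⌋
aboveFrom m n x y (N ∷ p)  = ⌊ x * n ≤? y * m ⌋ ∧ aboveFrom m n x (suc y) p
aboveFrom m n x y (E ∷ p)  = ⌊ x * n ≤? y * m ⌋ ∧ aboveFrom m n (suc x) y p

isDyck : ℕ → ℕ → List Step → Bool
isDyck m n p = aboveFrom m n 0 0 p

-- The set D_{m,n} of m×n rational Dyck paths (as a duplicate-free list).
Dyck : ℕ → ℕ → List (List Step)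
Dyck m n = filter (λ p → isDyck m n p ≟ᵇ true) (words m n)

coareaFrom : ℕ → List Step → List ℕ
coareaFrom x []      = []
coareaFrom x (N ∷ p) = x ∷ coareaFrom x p
coareaFrom x (E ∷ p) = coareaFrom (suc x) p

coarea : List Step → List ℕ
coarea = coareaFrom 0

elemℕ : ℕ → List ℕ → Bool
elemℕ i []       = false
elemℕ i (u ∷ us) = ⌊ i ≟ u ⌋ ∨' elemℕ i us
  where
  _∨'_ : Bool → Bool → Bool
  true  ∨' _ = true
  false ∨' b = b

-- least i ∈ {i₀, …, i₀+fuel-1} not in us; returns i₀+fuel if none.
firstMissing : ℕ → ℕ → List ℕ → ℕ
firstMissing i zero       us = i
firstMissing i (suc fuel) us = if elemℕ i us then firstMissing (suc i) fuel us else i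

run : ℕ → List Step → ℕ
run n p = firstMissing 1 n (coarea p)

-- ret(P): number of north steps from (i,j) with j*m - i*n < n.
-- (For Dyck paths j*m ≥ i*n, so this is j*m < i*n + n.)
retFrom : ℕ → ℕ → ℕ → ℕ → List Step → ℕ
retFrom m n i j []      = 0
retFrom m n i j (N ∷ p) =
  (if ⌊ j * m <? i * n + n ⌋ then 1 else 0) + retFrom m n i (suc j) p
retFrom m n i j (E ∷ p) = retFrom m n (suc i) j p

ret : ℕ → ℕ → List Step → ℕ
ret m n p = retFrom m n 0 0 p

-- composition type: lengths of maximal blocks of consecutive north steps.
-- compAux c p: c = length of the current (open) north block.
compAux : ℕ → List Step → List ℕ
compAux zero    []      = []
compAux (suc c) []      = suc c ∷ []
compAux c       (N ∷ p) = compAux (suc c) p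
compAux zero    (E ∷ p) = compAux zero p
compAux (suc c) (E ∷ p) = suc c ∷ compAux zero p

comp : List Step → List ℕ
comp = compAux 0

eqList : List ℕ → List ℕ → Bool
eqList []       []       = true
eqList (a ∷ as) (b ∷ bs) = ⌊ a ≟ b ⌋ ∧ eqList as bs
eqList _        _        = false

Dαkl : ℕ → ℕ → List ℕ → ℕ → ℕ → List (List Step)
Dαkl m n α k ℓ =
  filter (λ p → (eqList (comp p) α ∧ (⌊ run n p ≟ k ⌋ ∧ ⌊ ret m n p ≟ ℓ ⌋)) ≟ᵇ true)
         (Dyck m n)

IsComposition : ℕ → List ℕ → Set
IsComposition n α = All (λ a → 0 < a) α × (sum α ≡ n)
  where open import Data.Product using (_×_)

Iones : List ℕ → ℕ
Iones (1 ∷ α) = suc (Iones α)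
Iones _       = 0

-- ⌈ a / d ⌉ for d > 0 (value at d = 0 is irrelevant, set to 0)
ceilDiv : ℕ → ℕ → ℕ
ceilDiv a zero    = 0
ceilDiv a (suc d) = (a + d) / suc d

rr : ℕ → ℕ → List ℕ → ℕ
rr m n α = suc (Iones α) ⊓ ceilDiv n (m ∸ n)

-- A path P ∈ D_{m,α} is determined by the columns x₀ < x₁ < ⋯ at which its blocks of north steps
-- start; block i then starts at height hᵢ = α₁ + ⋯ + αᵢ and must satisfy xᵢ n ≤ hᵢ m.  In these
-- coordinates run(P) is the length of the initial stretch xᵢ = i, and ret(P) counts the blocks
-- that start in the rightmost column admissible at their height (a later north step of a block
-- never returns, as n < m).
--
-- For r = rr(α, m) ≤ k, ℓ this gives a bijection D^{(k, ℓ+1)}_{m,α} ≅ D^{(k+1, ℓ)}_{m,α}: insert the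
-- block start k right after the run, move each following block start one slot later and one
-- column to the right up to the first returning one, and delete that one.  Moved blocks stay
-- non-returning, and the inserted one does not return because every slot i ≥ r has room,
-- (i + 1) n ≤ hᵢ m: either one of the first i parts exceeds 1 (i > Iones α), or i (m − n) ≥ n.
-- For the same reason at most r blocks of the run return, so a returning block after the run
-- exists.  The inverse removes the last block start k of the run and moves the following block
-- starts back until one no longer fits, where it re-inserts a block in the rightmost admissible
-- column.  Composing these bijections carries (r + a, r + b − a) to (r + b, r).

module Submission where

open import Defs
open import Data.Bool using (Bool; true; false; _∧_)
open import Data.Bool.Properties using () renaming (_≟_ to _≟ᵇ_)
open import Data.Fin using (zero; suc)
open import Data.Fin.Properties using (injective⇒≤)
open import Data.List using (List; []; _∷_; _++_; [_]; length; lookup; map; replicate)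
open import Data.List.Membership.Propositional using (_∈_; _∉_)
open import Data.List.Membership.Propositional.Properties
  using (∈-++⁺ˡ; ∈-++⁺ʳ; ∈-++⁻; ∈-map⁺; ∈-map⁻; ∈-filter⁺; ∈-filter⁻; ∈-lookup)
open import Data.List.Properties using (∷-injectiveʳ; ++-assoc; length-++)
open import Data.List.Relation.Unary.All as All using (All; []; _∷_)
open import Data.List.Relation.Unary.All.Properties using (++⁻ˡ; replicate⁺)
open import Data.List.Relation.Unary.AllPairs using ([]; _∷_)
open import Data.List.Relation.Unary.Any using (here; there; index; tail)
open import Data.List.Relation.Unary.Any.Properties using (lookup-index)
open import Data.List.Relation.Unary.Unique.Propositional using (Unique)
import Data.List.Relation.Unary.Unique.Propositional.Properties as Unique
open import Data.Nat
open import Data.Nat.DivMod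
  using (_/_; _%_; m≡m%n+[m/n]*n; m%n<n; m/n*n≤m; m*n/n≡m; /-monoˡ-≤; m<n*o⇒m/o<n)
open import Data.Nat.ListAction using (sum)
open import Data.Nat.ListAction.Properties using (sum-++)
open import Data.Nat.Properties
open import Data.Product using (∃-syntax; _×_; _,_; proj₁; proj₂)
open import Data.Sum using (inj₁; inj₂)
open import Function using (_∘_; _$_)
open import Level using (Level)
open import Relation.Nullary using (¬_; Dec; yes; no; contradiction)
import Relation.Nullary.Decidable as Dec
open import Relation.Nullary.Decidable using (⌊_⌋)
open import Relation.Binary.PropositionalEquality hiding ([_])

-- Counting duplicate-free lists

private
  variable
    a b : Level
    A : Set a
    B : Set b

lookup-injective : ∀ {xs : List A} → Unique xs → ∀ {i j} → lookup xs i ≡ lookup xs j → i ≡ j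
lookup-injective (_ ∷ _) {zero} {zero} _ = refl
lookup-injective (x≢ ∷ _) {zero} {suc j} eq = contradiction eq (All.lookup x≢ (∈-lookup j))
lookup-injective (x≢ ∷ _) {suc i} {zero} eq = contradiction (sym eq) (All.lookup x≢ (∈-lookup i))
lookup-injective (_ ∷ xs!) {suc i} {suc j} eq = cong suc (lookup-injective xs! eq)

length-≤-by-injection : ∀ {xs : List A} {ys : List B} → Unique xs → (f : A → B) →
  (∀ {x} → x ∈ xs → f x ∈ ys) → (∀ {x y} → x ∈ xs → y ∈ xs → f x ≡ f y → x ≡ y) →
  length xs ≤ length ys
length-≤-by-injection {xs = xs} {ys} xs! f f∈ f-inj =
  injective⇒≤ {f = λ i → index (f∈ (∈-lookup i))} λ {i} {j} eq →
    lookup-injective xs! (f-inj (∈-lookup i) (∈-lookup j) (begin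
      f (lookup xs i)                     ≡⟨ lookup-index (f∈ (∈-lookup i)) ⟩
      lookup ys (index (f∈ (∈-lookup i))) ≡⟨ cong (lookup ys) eq ⟩
      lookup ys (index (f∈ (∈-lookup j))) ≡⟨ lookup-index (f∈ (∈-lookup j)) ⟨
      f (lookup xs j)                     ∎))
  where open ≡-Reasoning

length-≡-by-inverses : ∀ {xs : List A} {ys : List B} → Unique xs → Unique ys →
  (f : A → B) (g : B → A) →
  (∀ {x} → x ∈ xs → f x ∈ ys) → (∀ {y} → y ∈ ys → g y ∈ xs) →
  (∀ {x} → x ∈ xs → g (f x) ≡ x) → (∀ {y} → y ∈ ys → f (g y) ≡ y) →
  length xs ≡ length ys
length-≡-by-inverses xs! ys! f g f∈ g∈ gf fg = ≤-antisym
  (length-≤-by-injection xs! f f∈ λ x∈ y∈ eq → trans (sym (gf x∈)) (trans (cong g eq) (gf y∈)))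
  (length-≤-by-injection ys! g g∈ λ x∈ y∈ eq → trans (sym (fg x∈)) (trans (cong f eq) (fg y∈)))

⌊⌋≡true⁺ : ∀ {P : Set a} (P? : Dec P) → P → ⌊ P? ⌋ ≡ true
⌊⌋≡true⁺ (yes _) _ = refl
⌊⌋≡true⁺ (no ¬p) p = contradiction p ¬p

⌊⌋≡true⁻ : ∀ {P : Set a} (P? : Dec P) → ⌊ P? ⌋ ≡ true → P
⌊⌋≡true⁻ (yes p) _ = p

∧≡true⁻ : ∀ x {y} → x ∧ y ≡ true → x ≡ true × y ≡ true
∧≡true⁻ true y≡true = refl , y≡true

replicate-suc-++ : ∀ k (s : A) w → replicate (suc k) s ++ w ≡ replicate k s ++ s ∷ w
replicate-suc-++ zero s w = refl
replicate-suc-++ (suc k) s w = cong (s ∷_) (replicate-suc-++ k s w)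

-- Runs and missing values

elemℕ-∈ : ∀ {t us} → t ∈ us → elemℕ t us ≡ true
elemℕ-∈ {t} {u ∷ us} t∈ with t ≟ u
... | yes _ = refl
... | no t≢u = elemℕ-∈ (tail t≢u t∈)

elemℕ-∉ : ∀ {t us} → t ∉ us → elemℕ t us ≡ false
elemℕ-∉ {us = []} _ = refl
elemℕ-∉ {t} {u ∷ us} t∉ with t ≟ u
... | yes refl = contradiction (here refl) t∉
... | no _ = elemℕ-∉ (t∉ ∘ there)

firstMissing-≡ : ∀ fuel {i j us} → i ≤ j → j ≤ i + fuel →
  (∀ {t} → i ≤ t → t < j → t ∈ us) → j ∉ us → firstMissing i fuel us ≡ j
firstMissing-≡ zero {i} i≤j j≤i _ _ = ≤-antisym i≤j (≤-trans j≤i (≤-reflexive (+-identityʳ i)))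
firstMissing-≡ (suc fuel) {i} i≤j j≤ below j∉ with m≤n⇒m<n∨m≡n i≤j
... | inj₁ i<j rewrite elemℕ-∈ (below ≤-refl i<j) =
  firstMissing-≡ fuel i<j (≤-trans j≤ (≤-reflexive (+-suc i fuel))) (below ∘ ≤-trans (n≤1+n i)) j∉
... | inj₂ refl rewrite elemℕ-∉ j∉ = refl

runLength : ℕ → List ℕ → ℕ
runLength i [] = 0
runLength i (x ∷ xs) with x ≟ i
... | yes _ = suc (runLength (suc i) xs)
... | no _ = 0

runLength-hit : ∀ i xs → runLength i (i ∷ xs) ≡ suc (runLength (suc i) xs)
runLength-hit i xs with i ≟ i
... | yes _ = refl
... | no i≢i = contradiction refl i≢i

runLength-above : ∀ {i xs} → All (suc i ≤_) xs → runLength i xs ≡ 0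
runLength-above [] = refl
runLength-above {i} {x ∷ _} (i<x ∷ _) with x ≟ i
... | yes x≡i = contradiction x≡i (>⇒≢ i<x)
... | no _ = refl

runLength≤length : ∀ i xs → runLength i xs ≤ length xs
runLength≤length i [] = z≤n
runLength≤length i (x ∷ xs) with x ≟ i
... | yes _ = s≤s (runLength≤length (suc i) xs)
... | no _ = z≤n

∈-runLength : ∀ {i t} xs → i ≤ t → t < i + runLength i xs → t ∈ xs
∈-runLength {i} [] i≤t t< = contradiction (≤-trans t< (≤-reflexive (+-identityʳ i))) (≤⇒≯ i≤t)
∈-runLength {i} {t} (x ∷ xs) i≤t t< with x ≟ i
... | no _ = contradiction (≤-trans t< (≤-reflexive (+-identityʳ i))) (≤⇒≯ i≤t)
... | yes refl with m≤n⇒m<n∨m≡n i≤t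
...   | inj₂ refl = here refl
...   | inj₁ i<t = there (∈-runLength xs i<t (≤-trans t< (≤-reflexive (+-suc x _))))

-- Compositions

length≤sum : ∀ {as} → All (0 <_) as → length as ≤ sum as
length≤sum [] = z≤n
length≤sum (a>0 ∷ as>0) = +-mono-≤ a>0 (length≤sum as>0)

Iones<length⇒length<sum : ∀ β {γ} → All (0 <_) β → Iones (β ++ γ) < length β → length β < sum β
Iones<length⇒length<sum (suc zero ∷ β) (_ ∷ β>0) (s≤s ones<) =
  s≤s (Iones<length⇒length<sum β β>0 ones<)
Iones<length⇒length<sum (suc (suc b) ∷ β) (_ ∷ β>0) _ =
  s≤s (s≤s (≤-trans (length≤sum β>0) (m≤n+m _ b)))

record Boundary (α : List ℕ) (i h : ℕ) (rest : List ℕ) : Set where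
  field
    prefix : List ℕ
    splits : prefix ++ rest ≡ α
    length≡ : length prefix ≡ i
    sum≡ : sum prefix ≡ h

boundary-start : ∀ {α} → Boundary α 0 0 α
boundary-start = record { prefix = [] ; splits = refl ; length≡ = refl ; sum≡ = refl }

boundary-step : ∀ {α i h a as} → Boundary α i h (a ∷ as) → Boundary α (suc i) (h + a) as
boundary-step {a = a} {as} record { prefix = β ; splits = β++a∷as≡α ; length≡ = |β|≡i ; sum≡ = Σβ≡h } =
  record
  { prefix = β ++ [ a ]
  ; splits = trans (++-assoc β [ a ] as) β++a∷as≡α
  ; length≡ = trans (length-++ β) (trans (+-comm (length β) 1) (cong suc |β|≡i))
  ; sum≡ = trans (sum-++ β [ a ]) (cong₂ _+_ Σβ≡h (+-identityʳ a))
  }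

boundary-positive : ∀ {α i h rest} → All (0 <_) α → (b : Boundary α i h rest) →
  All (0 <_) (Boundary.prefix b)
boundary-positive α>0 record { prefix = β ; splits = refl } = ++⁻ˡ β α>0

boundary-index≤height : ∀ {α i h rest} → All (0 <_) α → Boundary α i h rest → i ≤ h
boundary-index≤height α>0 b@record { length≡ = refl ; sum≡ = refl } =
  length≤sum (boundary-positive α>0 b)

boundary-Iones<⇒index<height : ∀ {α i h rest} → All (0 <_) α → Boundary α i h rest →
  Iones α < i → i < h
boundary-Iones<⇒index<height α>0 b@record { prefix = β ; splits = refl ; length≡ = refl ; sum≡ = refl } =
  Iones<length⇒length<sum β (boundary-positive α>0 b)

ceilDiv≤⇒≤* : ∀ a d {i} → ceilDiv a (suc d) ≤ i → a ≤ i * suc d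
ceilDiv≤⇒≤* a d {i} q≤i = +-cancelʳ-≤ d a (i * suc d) (≤-pred (begin-strict
  a + d                                    ≡⟨ m≡m%n+[m/n]*n (a + d) (suc d) ⟩
  (a + d) % suc d + (a + d) / suc d * suc d <⟨ +-monoˡ-< _ (m%n<n (a + d) (suc d)) ⟩
  suc d + (a + d) / suc d * suc d          ≤⟨ +-monoʳ-≤ (suc d) (*-monoˡ-≤ (suc d) q≤i) ⟩
  suc d + i * suc d                        ≡⟨ cong suc (+-comm d (i * suc d)) ⟩
  suc (i * suc d + d)                      ∎))
  where open ≤-Reasoning

-- Lattice words

blockStartsFrom : (x : ℕ) (inBlock : Bool) → List Step → List ℕ
blockStartsFrom x _ [] = []
blockStartsFrom x _ (E ∷ p) = blockStartsFrom (suc x) false p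
blockStartsFrom x false (N ∷ p) = x ∷ blockStartsFrom x true p
blockStartsFrom x true (N ∷ p) = blockStartsFrom x true p

blockStarts : List Step → List ℕ
blockStarts = blockStartsFrom 0 false

blockStartsFrom-E*-end : ∀ k {x b} → blockStartsFrom x b (replicate k E) ≡ []
blockStartsFrom-E*-end zero = refl
blockStartsFrom-E*-end (suc k) {x} = blockStartsFrom-E*-end k {suc x}

words-N∷ : ∀ {w e k} → w ∈ words e k → N ∷ w ∈ words e (suc k)
words-N∷ {e = zero} w∈ = ∈-map⁺ (N ∷_) w∈
words-N∷ {e = suc e} w∈ = ∈-++⁺ˡ (∈-map⁺ (N ∷_) w∈)

words-E∷ : ∀ {w e k} → w ∈ words e k → E ∷ w ∈ words (suc e) k
words-E∷ {k = zero} w∈ = ∈-map⁺ (E ∷_) w∈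
words-E∷ {e = e} {suc k} w∈ = ∈-++⁺ʳ (map (N ∷_) (words (suc e) k)) (∈-map⁺ (E ∷_) w∈)

words-[]⁻ : ∀ {e k} → [] ∈ words e k → e ≡ 0 × k ≡ 0
words-[]⁻ {zero} {zero} _ = refl , refl
words-[]⁻ {zero} {suc k} []∈ with _ , _ , () ← ∈-map⁻ (N ∷_) []∈
words-[]⁻ {suc e} {zero} []∈ with _ , _ , () ← ∈-map⁻ (E ∷_) []∈
words-[]⁻ {suc e} {suc k} []∈ with ∈-++⁻ (map (N ∷_) (words (suc e) k)) []∈
... | inj₁ []∈ˡ with _ , _ , () ← ∈-map⁻ (N ∷_) []∈ˡ
... | inj₂ []∈ʳ with _ , _ , () ← ∈-map⁻ (E ∷_) []∈ʳ

words-E∷⁻ : ∀ {w e k} → E ∷ w ∈ words e k → ∃[ e′ ] e ≡ suc e′ × w ∈ words e′ k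
words-E∷⁻ {e = zero} {zero} (here ())
words-E∷⁻ {e = zero} {zero} (there ())
words-E∷⁻ {e = zero} {suc k} w∈ with _ , _ , () ← ∈-map⁻ (N ∷_) w∈
words-E∷⁻ {e = suc e} {zero} w∈ with _ , w∈′ , refl ← ∈-map⁻ (E ∷_) w∈ = e , refl , w∈′
words-E∷⁻ {e = suc e} {suc k} w∈ with ∈-++⁻ (map (N ∷_) (words (suc e) k)) w∈
... | inj₁ w∈ˡ with _ , _ , () ← ∈-map⁻ (N ∷_) w∈ˡ
... | inj₂ w∈ʳ with _ , w∈′ , refl ← ∈-map⁻ (E ∷_) w∈ʳ = e , refl , w∈′

words-N∷⁻ : ∀ {w e k} → N ∷ w ∈ words e k → ∃[ k′ ] k ≡ suc k′ × w ∈ words e k′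
words-N∷⁻ {e = zero} {zero} (here ())
words-N∷⁻ {e = zero} {zero} (there ())
words-N∷⁻ {e = zero} {suc k} w∈ with _ , w∈′ , refl ← ∈-map⁻ (N ∷_) w∈ = k , refl , w∈′
words-N∷⁻ {e = suc e} {zero} w∈ with _ , _ , () ← ∈-map⁻ (E ∷_) w∈
words-N∷⁻ {e = suc e} {suc k} w∈ with ∈-++⁻ (map (N ∷_) (words (suc e) k)) w∈
... | inj₁ w∈ˡ with _ , w∈′ , refl ← ∈-map⁻ (N ∷_) w∈ˡ = k , refl , w∈′
... | inj₂ w∈ʳ with _ , _ , () ← ∈-map⁻ (E ∷_) w∈ʳ

words-unique : ∀ e k → Unique (words e k)
words-unique zero zero = [] ∷ []
words-unique zero (suc k) = Unique.map⁺ ∷-injectiveʳ (words-unique zero k)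
words-unique (suc e) zero = Unique.map⁺ ∷-injectiveʳ (words-unique e zero)
words-unique (suc e) (suc k) = Unique.++⁺
  (Unique.map⁺ ∷-injectiveʳ (words-unique (suc e) k))
  (Unique.map⁺ ∷-injectiveʳ (words-unique e (suc k)))
  disjoint
  where
  disjoint : ∀ {w} → ¬ (w ∈ map (N ∷_) (words (suc e) k) × w ∈ map (E ∷_) (words e (suc k)))
  disjoint (N∷∈ , E∷∈) with ∈-map⁻ (N ∷_) N∷∈ | ∈-map⁻ (E ∷_) E∷∈
  ... | _ , _ , refl | _ , _ , ()

compAux-E* : ∀ k w → compAux 0 (replicate k E ++ w) ≡ compAux 0 w
compAux-E* zero w = refl
compAux-E* (suc k) w = compAux-E* k w

compAux-E*-end : ∀ k → compAux 0 (replicate k E) ≡ []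
compAux-E*-end zero = refl
compAux-E*-end (suc k) = compAux-E*-end k

compAux-N* : ∀ a {j} w → compAux j (replicate a N ++ w) ≡ compAux (j + a) w
compAux-N* zero {j} w rewrite +-identityʳ j = refl
compAux-N* (suc a) {zero} w = compAux-N* a {1} w
compAux-N* (suc a) {suc j} w rewrite +-suc j a = compAux-N* a {suc (suc j)} w

coareaFrom-E* : ∀ k {c x} w → c + k ≡ x → coareaFrom c (replicate k E ++ w) ≡ coareaFrom x w
coareaFrom-E* zero {c} w c+0≡x = cong (λ y → coareaFrom y w) (trans (sym (+-identityʳ c)) c+0≡x)
coareaFrom-E* (suc k) {c} w c+k≡x = coareaFrom-E* k w (trans (sym (+-suc c k)) c+k≡x)

coareaFrom-N* : ∀ a {x} w → coareaFrom x (replicate a N ++ w) ≡ replicate a x ++ coareaFrom x w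
coareaFrom-N* zero w = refl
coareaFrom-N* (suc a) {x} w = cong (x ∷_) (coareaFrom-N* a w)

coareaFrom-E*-end : ∀ k {c} → coareaFrom c (replicate k E) ≡ []
coareaFrom-E*-end zero = refl
coareaFrom-E*-end (suc k) {c} = coareaFrom-E*-end k {suc c}

blockStartsFrom-E* : ∀ k {c x} w → c + k ≡ x →
  blockStartsFrom c false (replicate k E ++ w) ≡ blockStartsFrom x false w
blockStartsFrom-E* zero {c} w c+0≡x =
  cong (λ y → blockStartsFrom y false w) (trans (sym (+-identityʳ c)) c+0≡x)
blockStartsFrom-E* (suc k) {c} w c+k≡x = blockStartsFrom-E* k w (trans (sym (+-suc c k)) c+k≡x)

blockStartsFrom-N* : ∀ a {x} w → blockStartsFrom x true (replicate a N ++ w) ≡ blockStartsFrom x true w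
blockStartsFrom-N* zero w = refl
blockStartsFrom-N* (suc a) w = blockStartsFrom-N* a w

words-E* : ∀ k {w e l} → w ∈ words e l → replicate k E ++ w ∈ words (k + e) l
words-E* zero w∈ = w∈
words-E* (suc k) {e = e} {l} w∈ = words-E∷ {e = k + e} {l} (words-E* k {e = e} {l} w∈)

words-N* : ∀ a {w e l} → w ∈ words e l → replicate a N ++ w ∈ words e (a + l)
words-N* zero w∈ = w∈
words-N* (suc a) {e = e} {l} w∈ = words-N∷ {e = e} {a + l} (words-N* a {e = e} {l} w∈)

words-E*-end : ∀ k → replicate k E ∈ words k 0
words-E*-end zero = here refl
words-E*-end (suc k) = words-E∷ {e = k} {0} (words-E*-end k)

coareaOfBlocks : List ℕ → List ℕ → List ℕ
coareaOfBlocks (a ∷ as) (x ∷ xs) = replicate a x ++ coareaOfBlocks as xs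
coareaOfBlocks _ _ = []

∈-coareaOfBlocks⁻ : ∀ {t} as xs → t ∈ coareaOfBlocks as xs → t ∈ xs
∈-coareaOfBlocks⁻ (a ∷ as) (x ∷ xs) t∈ with ∈-++⁻ (replicate a x) t∈
... | inj₁ t∈x* = here (All.lookup (replicate⁺ {P = _≡ x} a refl) t∈x*)
... | inj₂ t∈rest = there (∈-coareaOfBlocks⁻ as xs t∈rest)

eqList-sound : ∀ xs ys → eqList xs ys ≡ true → xs ≡ ys
eqList-sound [] [] _ = refl
eqList-sound (x ∷ xs) (y ∷ ys) eq with x ≟ y
... | yes refl = cong (x ∷_) (eqList-sound xs ys eq)
eqList-sound (x ∷ xs) (y ∷ ys) () | no _

eqList-refl : ∀ xs → eqList xs xs ≡ true
eqList-refl [] = refl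
eqList-refl (x ∷ xs) with x ≟ x
... | yes _ = eqList-refl xs
... | no x≢x = contradiction refl x≢x

module _ {m n : ℕ} {α : List ℕ} {k ℓ : ℕ} where

  private
    statistics : List Step → Bool
    statistics q = eqList (comp q) α ∧ (⌊ run n q ≟ k ⌋ ∧ ⌊ ret m n q ≟ ℓ ⌋)

  ∈-Dαkl⁻ : ∀ {p} → p ∈ Dαkl m n α k ℓ →
    p ∈ Dyck m n × comp p ≡ α × run n p ≡ k × ret m n p ≡ ℓ
  ∈-Dαkl⁻ {p} p∈ with ∈-filter⁻ (λ q → statistics q ≟ᵇ true) {xs = Dyck m n} p∈
  ... | p∈Dyck , stats with ∧≡true⁻ (eqList (comp p) α) stats
  ...   | comp≡ , run∧ret with ∧≡true⁻ ⌊ run n p ≟ k ⌋ run∧ret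
  ...     | run≡ , ret≡ =
    p∈Dyck , eqList-sound (comp p) α comp≡ ,
    ⌊⌋≡true⁻ (run n p ≟ k) run≡ , ⌊⌋≡true⁻ (ret m n p ≟ ℓ) ret≡

  ∈-Dαkl⁺ : ∀ {p} → p ∈ Dyck m n → comp p ≡ α → run n p ≡ k → ret m n p ≡ ℓ →
    p ∈ Dαkl m n α k ℓ
  ∈-Dαkl⁺ {p} p∈Dyck comp≡ run≡ ret≡ = ∈-filter⁺ (λ q → statistics q ≟ᵇ true) p∈Dyck
    (cong₂ _∧_ (trans (cong (λ β → eqList β α) comp≡) (eqList-refl α))
               (cong₂ _∧_ (⌊⌋≡true⁺ (run n p ≟ k) run≡) (⌊⌋≡true⁺ (ret m n p ≟ ℓ) ret≡)))

  Dαkl-unique : Unique (Dαkl m n α k ℓ)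
  Dαkl-unique = Unique.filter⁺ _ (Unique.filter⁺ _ (words-unique m n))

-- Paths described by their block starts

module RationalPaths (m n : ℕ) (0<n : 0 < n) (n<m : n < m) where

  n≤m : n ≤ m
  n≤m = <⇒≤ n<m

  instance
    n≢0 : NonZero n
    n≢0 = >-nonZero 0<n

  -- A record rather than a synonym, so that h and x can be inferred from a proof.
  record Returns (h x : ℕ) : Set where
    constructor returning
    field
      below : h * m < x * n + n

  returns? : ∀ h x → Dec (Returns h x)
  returns? h x = Dec.map′ returning Returns.below (h * m <? x * n + n)

  admissible⇒column<m : ∀ {x h} → x * n ≤ h * m → h < n → x < m
  admissible⇒column<m {x} {h} adm h<n = *-cancelʳ-< n x m (begin-strict
    x * n ≤⟨ adm ⟩
    h * m <⟨ *-monoˡ-< m {{>-nonZero (<-trans 0<n n<m)}} h<n ⟩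
    n * m ≡⟨ *-comm n m ⟩
    m * n ∎)
    where open ≤-Reasoning

  admissible-mono : ∀ {x h h′} → h ≤ h′ → x * n ≤ h * m → x * n ≤ h′ * m
  admissible-mono h≤h′ adm = ≤-trans adm (*-monoˡ-≤ m h≤h′)

  ¬returns⇒suc-admissible : ∀ {x h} → ¬ Returns h x → suc x * n ≤ h * m
  ¬returns⇒suc-admissible {x} ¬ret = ≤-trans (≤-reflexive (+-comm n (x * n))) (≮⇒≥ (¬ret ∘ returning))

  suc-admissible⇒¬returns : ∀ {x h} → suc x * n ≤ h * m → ¬ Returns h x
  suc-admissible⇒¬returns {x} adm (returning ret) = <⇒≱ ret (≤-trans (≤-reflexive (+-comm (x * n) n)) adm)

  admissible⇒¬returns-above : ∀ {x h h′} → h < h′ → x * n ≤ h * m → ¬ Returns h′ x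
  admissible⇒¬returns-above {x} {h} {h′} h<h′ adm = suc-admissible⇒¬returns {x} {h′} (begin
    n + x * n  ≤⟨ +-mono-≤ n≤m adm ⟩
    m + h * m  ≤⟨ *-monoˡ-≤ m h<h′ ⟩
    h′ * m     ∎)
    where open ≤-Reasoning

  maxColumn : ℕ → ℕ
  maxColumn h = h * m / n

  maxColumn-admissible : ∀ h → maxColumn h * n ≤ h * m
  maxColumn-admissible h = m/n*n≤m (h * m) n

  maxColumn-returns : ∀ h → Returns h (maxColumn h)
  maxColumn-returns h = returning $ begin-strict
    h * m                       ≡⟨ m≡m%n+[m/n]*n (h * m) n ⟩
    h * m % n + maxColumn h * n <⟨ +-monoˡ-< _ (m%n<n (h * m) n) ⟩
    n + maxColumn h * n         ≡⟨ +-comm n _ ⟩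
    maxColumn h * n + n         ∎
    where open ≤-Reasoning

  admissible⇒≤maxColumn : ∀ {x h} → x * n ≤ h * m → x ≤ maxColumn h
  admissible⇒≤maxColumn {x} {h} adm = subst (_≤ maxColumn h) (m*n/n≡m x n) (/-monoˡ-≤ n adm)

  inadmissible⇒maxColumn< : ∀ {x h} → ¬ (x * n ≤ h * m) → maxColumn h < x
  inadmissible⇒maxColumn< ¬adm = m<n*o⇒m/o<n (≰⇒> ¬adm)

  returns⇒maxColumn : ∀ {x h} → x * n ≤ h * m → Returns h x → maxColumn h ≡ x
  returns⇒maxColumn {x} {h} adm ret = ≤-antisym
    (≤-pred (inadmissible⇒maxColumn< {suc x} {h} λ adm′ → suc-admissible⇒¬returns {x} {h} adm′ ret))
    (admissible⇒≤maxColumn {x} {h} adm)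

  fromBlocks : ℕ → List ℕ → List ℕ → List Step
  fromBlocks c (a ∷ as) (x ∷ xs) = replicate (x ∸ c) E ++ replicate a N ++ fromBlocks x as xs
  fromBlocks c _ _ = replicate (m ∸ c) E

  data Admissible : ℕ → ℕ → List ℕ → List ℕ → Set where
    [] : ∀ {lo h} → Admissible lo h [] []
    block : ∀ {lo h a as x xs} → 0 < a → lo ≤ x → x * n ≤ h * m →
            Admissible (suc x) (h + a) as xs → Admissible lo h (a ∷ as) (x ∷ xs)

  returnsFrom : ℕ → List ℕ → List ℕ → ℕ
  returnsFrom h (a ∷ as) (x ∷ xs) with returns? h x
  ... | yes _ = suc (returnsFrom (h + a) as xs)
  ... | no _ = returnsFrom (h + a) as xs
  returnsFrom h _ _ = 0

  returnsFrom-returns : ∀ {h a as x xs} → Returns h x →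
    returnsFrom h (a ∷ as) (x ∷ xs) ≡ suc (returnsFrom (h + a) as xs)
  returnsFrom-returns {h} {x = x} ret with returns? h x
  ... | yes _ = refl
  ... | no ¬ret = contradiction ret ¬ret

  returnsFrom-¬returns : ∀ {h a as x xs} → ¬ Returns h x →
    returnsFrom h (a ∷ as) (x ∷ xs) ≡ returnsFrom (h + a) as xs
  returnsFrom-¬returns {h} {x = x} ¬ret with returns? h x
  ... | yes ret = contradiction ret ¬ret
  ... | no _ = refl

  returnsFrom-∷-suc : ∀ {h a as x ys zs} → suc (returnsFrom (h + a) as ys) ≡ returnsFrom (h + a) as zs →
    suc (returnsFrom h (a ∷ as) (x ∷ ys)) ≡ returnsFrom h (a ∷ as) (x ∷ zs)
  returnsFrom-∷-suc {h} {x = x} eq with returns? h x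
  ... | yes _ = cong suc eq
  ... | no _ = eq

  admissible-weaken : ∀ {lo lo′ h as xs} → lo′ ≤ lo → Admissible lo h as xs → Admissible lo′ h as xs
  admissible-weaken _ [] = []
  admissible-weaken lo′≤lo (block a>0 lo≤x adm rest) = block a>0 (≤-trans lo′≤lo lo≤x) adm rest

  admissible-lowerBound : ∀ {lo h as xs} → Admissible lo h as xs → All (lo ≤_) xs
  admissible-lowerBound [] = []
  admissible-lowerBound (block {x = x} _ lo≤x _ rest) =
    lo≤x ∷ All.map (≤-trans (≤-trans lo≤x (n≤1+n x))) (admissible-lowerBound rest)

  admissible-withBound : ∀ {lo lo′ h as xs} → All (lo′ ≤_) xs → Admissible lo h as xs →
    Admissible lo′ h as xs
  admissible-withBound [] [] = []
  admissible-withBound (lo′≤x ∷ _) (block a>0 _ adm rest) = block a>0 lo′≤x adm rest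

  admissible-length≤sum : ∀ {lo h as xs} → Admissible lo h as xs → length xs ≤ sum as
  admissible-length≤sum [] = z≤n
  admissible-length≤sum (block a>0 _ _ rest) = +-mono-≤ a>0 (admissible-length≤sum rest)

  column<m : ∀ {lo h a as x xs} → Admissible lo h (a ∷ as) (x ∷ xs) → h + sum (a ∷ as) ≡ n → x < m
  column<m {h = h} {a} {as} {x} (block a>0 _ adm _) h+Σ≡n =
    admissible⇒column<m {x} {h} adm
      (<-≤-trans (m<m+n h (<-≤-trans a>0 (m≤m+n a (sum as)))) (≤-reflexive h+Σ≡n))

  fromBlocks-E∷ : ∀ {c h as xs} → Admissible (suc c) h as xs → c < m →
    fromBlocks c as xs ≡ E ∷ fromBlocks (suc c) as xs
  fromBlocks-E∷ [] c<m = cong (λ k → replicate k E) (+-∸-assoc 1 c<m)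
  fromBlocks-E∷ {c} (block {a = a} {as} {x} {xs} _ c<x _ _) _ =
    cong (λ k → replicate k E ++ replicate a N ++ fromBlocks x as xs) (+-∸-assoc 1 c<x)

  aboveFrom-E* : ∀ k {c x h} w → c + k ≡ x → x * n ≤ h * m →
    aboveFrom m n c h (replicate k E ++ w) ≡ aboveFrom m n x h w
  aboveFrom-E* zero {c} {h = h} w c+0≡x _ =
    cong (λ y → aboveFrom m n y h w) (trans (sym (+-identityʳ c)) c+0≡x)
  aboveFrom-E* (suc k) {c} {x} {h} w c+k≡x adm with c * n ≤? h * m
  ... | no ¬adm = contradiction (≤-trans (*-monoˡ-≤ n (subst (c ≤_) c+k≡x (m≤m+n c (suc k)))) adm) ¬adm
  ... | yes _ = aboveFrom-E* k w (trans (sym (+-suc c k)) c+k≡x) adm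

  aboveFrom-N* : ∀ a {x h} w → x * n ≤ h * m →
    aboveFrom m n x h (replicate a N ++ w) ≡ aboveFrom m n x (h + a) w
  aboveFrom-N* zero {h = h} w _ rewrite +-identityʳ h = refl
  aboveFrom-N* (suc a) {x} {h} w adm with x * n ≤? h * m
  ... | no ¬adm = contradiction adm ¬adm
  ... | yes _ rewrite +-suc h a = aboveFrom-N* a w (admissible-mono {x} (n≤1+n h) adm)

  aboveFrom-E*-end : ∀ k {c h} → (c + k) * n ≤ h * m → aboveFrom m n c h (replicate k E) ≡ true
  aboveFrom-E*-end zero {c} {h} adm =
    ⌊⌋≡true⁺ (c * n ≤? h * m) (subst (λ c′ → c′ * n ≤ h * m) (+-identityʳ c) adm)
  aboveFrom-E*-end (suc k) {c} {h} adm with c * n ≤? h * m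
  ... | no ¬adm = contradiction (≤-trans (*-monoˡ-≤ n (m≤m+n c (suc k))) adm) ¬adm
  ... | yes _ rewrite +-suc c k = aboveFrom-E*-end k adm

  retFrom-E* : ∀ k {c x h} w → c + k ≡ x → retFrom m n c h (replicate k E ++ w) ≡ retFrom m n x h w
  retFrom-E* zero {c} {h = h} w c+0≡x =
    cong (λ y → retFrom m n y h w) (trans (sym (+-identityʳ c)) c+0≡x)
  retFrom-E* (suc k) {c} w c+k≡x = retFrom-E* k w (trans (sym (+-suc c k)) c+k≡x)

  retFrom-E*-end : ∀ k {c h} → retFrom m n c h (replicate k E) ≡ 0
  retFrom-E*-end zero = refl
  retFrom-E*-end (suc k) {c} = retFrom-E*-end k {suc c}

  retFrom-N* : ∀ a {x h} w → x * n ≤ h * m →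
    retFrom m n x (suc h) (replicate a N ++ w) ≡ retFrom m n x (suc h + a) w
  retFrom-N* zero {h = h} w _ rewrite +-identityʳ h = refl
  retFrom-N* (suc a) {x} {h} w adm with suc h * m <? x * n + n
  ... | yes ret = contradiction (returning ret) (admissible⇒¬returns-above {x} (n<1+n h) adm)
  ... | no _ rewrite +-suc h a = retFrom-N* a w (admissible-mono {x} (n≤1+n h) adm)

  aboveFrom-E∷⁻ : ∀ {c h} p → aboveFrom m n c h (E ∷ p) ≡ true → aboveFrom m n (suc c) h p ≡ true
  aboveFrom-E∷⁻ {c} {h} p above with c * n ≤? h * m
  aboveFrom-E∷⁻ p above | yes _ = above
  aboveFrom-E∷⁻ p () | no _

  aboveFrom-N∷⁻ : ∀ {c h} p → aboveFrom m n c h (N ∷ p) ≡ true →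
    c * n ≤ h * m × aboveFrom m n c (suc h) p ≡ true
  aboveFrom-N∷⁻ {c} {h} p above with c * n ≤? h * m
  aboveFrom-N∷⁻ p above | yes adm = adm , above
  aboveFrom-N∷⁻ p () | no _

  isDyck-fromBlocks : ∀ {c h as xs} → Admissible c h as xs → h + sum as ≡ n → c ≤ m →
    aboveFrom m n c h (fromBlocks c as xs) ≡ true
  isDyck-fromBlocks {c} {h} [] h+0≡n c≤m = aboveFrom-E*-end (m ∸ c) (≤-reflexive (begin
    (c + (m ∸ c)) * n ≡⟨ cong (_* n) (m+[n∸m]≡n c≤m) ⟩
    m * n             ≡⟨ *-comm m n ⟩
    n * m             ≡⟨ cong (_* m) (trans (sym h+0≡n) (+-identityʳ h)) ⟩
    h * m             ∎))
    where open ≡-Reasoning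
  isDyck-fromBlocks {c} {h} bs@(block {a = a} {as} {x} {xs} _ c≤x adm rest) h+Σ≡n c≤m = begin
    aboveFrom m n c h (replicate (x ∸ c) E ++ replicate a N ++ fromBlocks x as xs)
      ≡⟨ aboveFrom-E* (x ∸ c) _ (m+[n∸m]≡n c≤x) adm ⟩
    aboveFrom m n x h (replicate a N ++ fromBlocks x as xs)
      ≡⟨ aboveFrom-N* a _ adm ⟩
    aboveFrom m n x (h + a) (fromBlocks x as xs)
      ≡⟨ isDyck-fromBlocks (admissible-weaken (n≤1+n x) rest) (trans (+-assoc h a (sum as)) h+Σ≡n)
           (<⇒≤ (column<m bs h+Σ≡n)) ⟩
    true ∎
    where open ≡-Reasoning

  comp-fromBlocks : ∀ {c h as xs} → Admissible c h as xs → h + sum as ≡ n →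
    compAux 0 (fromBlocks c as xs) ≡ as
  comp-fromBlocks {c} [] _ = compAux-E*-end (m ∸ c)
  comp-fromBlocks {c} {h} bs@(block {a = suc a} {as} {x} {xs} _ _ _ rest) h+Σ≡n = begin
    compAux 0 (replicate (x ∸ c) E ++ replicate (suc a) N ++ fromBlocks x as xs)
      ≡⟨ compAux-E* (x ∸ c) _ ⟩
    compAux 0 (replicate (suc a) N ++ fromBlocks x as xs)
      ≡⟨ compAux-N* (suc a) {0} _ ⟩
    compAux (suc a) (fromBlocks x as xs)
      ≡⟨ cong (compAux (suc a)) (fromBlocks-E∷ rest (column<m bs h+Σ≡n)) ⟩
    suc a ∷ compAux 0 (fromBlocks (suc x) as xs)
      ≡⟨ cong (suc a ∷_) (comp-fromBlocks rest (trans (+-assoc h (suc a) (sum as)) h+Σ≡n)) ⟩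
    suc a ∷ as ∎
    where open ≡-Reasoning

  coarea-fromBlocks : ∀ {c h as xs} → Admissible c h as xs →
    coareaFrom c (fromBlocks c as xs) ≡ coareaOfBlocks as xs
  coarea-fromBlocks {c} [] = coareaFrom-E*-end (m ∸ c)
  coarea-fromBlocks {c} (block {a = a} {as} {x} {xs} _ c≤x _ rest) = begin
    coareaFrom c (replicate (x ∸ c) E ++ replicate a N ++ fromBlocks x as xs)
      ≡⟨ coareaFrom-E* (x ∸ c) _ (m+[n∸m]≡n c≤x) ⟩
    coareaFrom x (replicate a N ++ fromBlocks x as xs)
      ≡⟨ coareaFrom-N* a _ ⟩
    replicate a x ++ coareaFrom x (fromBlocks x as xs)
      ≡⟨ cong (replicate a x ++_) (coarea-fromBlocks (admissible-weaken (n≤1+n x) rest)) ⟩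
    replicate a x ++ coareaOfBlocks as xs ∎
    where open ≡-Reasoning

  ∈-coareaOfBlocks⁺ : ∀ {lo h as xs t} → Admissible lo h as xs → t ∈ xs → t ∈ coareaOfBlocks as xs
  ∈-coareaOfBlocks⁺ (block {a = suc a} _ _ _ _) (here refl) = here refl
  ∈-coareaOfBlocks⁺ (block {a = a} {x = x} _ _ _ rest) (there t∈) =
    ∈-++⁺ʳ (replicate a x) (∈-coareaOfBlocks⁺ rest t∈)

  runLength∉ : ∀ {i h as xs} → Admissible i h as xs → i + runLength i xs ∉ xs
  runLength∉ {i} (block {x = x} {xs} _ i≤x _ rest) with x ≟ i
  ... | yes refl = λ where
    (here eq) → m+1+n≢m x eq
    (there t∈) → runLength∉ rest (subst (_∈ xs) (+-suc x _) t∈)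
  ... | no x≢i = λ where
    (here eq) → x≢i (sym (trans (sym (+-identityʳ i)) eq))
    (there t∈) →
      <⇒≱ (≤-trans (s≤s i≤x) (All.lookup (admissible-lowerBound rest) t∈)) (≤-reflexive (+-identityʳ i))

  run-fromBlocks : ∀ {α xs} → Admissible 0 0 α xs → sum α ≡ n →
    run n (fromBlocks 0 α xs) ≡ runLength 0 xs
  run-fromBlocks {α} {xs} adm Σ≡n = begin
    firstMissing 1 n (coarea (fromBlocks 0 α xs))
      ≡⟨ cong (firstMissing 1 n) (coarea-fromBlocks adm) ⟩
    firstMissing 1 n (coareaOfBlocks α xs)
      ≡⟨ firstMissing-≡ n (1≤runLength adm Σ≡n) runLength≤1+n
           (λ 1≤t t< → ∈-coareaOfBlocks⁺ adm (∈-runLength xs z≤n t<))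
           (runLength∉ adm ∘ ∈-coareaOfBlocks⁻ α xs) ⟩
    runLength 0 xs ∎
    where
    open ≡-Reasoning
    1≤runLength : ∀ {α xs} → Admissible 0 0 α xs → sum α ≡ n → 1 ≤ runLength 0 xs
    1≤runLength [] Σ≡n = contradiction (sym Σ≡n) (>⇒≢ 0<n)
    1≤runLength (block {x = zero} {xs} _ _ _ _) _ = subst (1 ≤_) (sym (runLength-hit 0 xs)) (s≤s z≤n)
    1≤runLength (block {x = suc x} _ _ adm _) _ = contradiction adm (<⇒≱ (≤-trans 0<n (m≤m+n n (x * n))))
    runLength≤1+n : runLength 0 xs ≤ 1 + n
    runLength≤1+n = ≤-trans (runLength≤length 0 xs)
      (≤-trans (admissible-length≤sum adm) (≤-trans (≤-reflexive Σ≡n) (n≤1+n n)))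

  ret-fromBlocks : ∀ {c h as xs} → Admissible c h as xs →
    retFrom m n c h (fromBlocks c as xs) ≡ returnsFrom h as xs
  ret-fromBlocks {c} [] = retFrom-E*-end (m ∸ c)
  ret-fromBlocks {c} {h} (block {a = suc a} {as} {x} {xs} _ c≤x adm rest)
    rewrite retFrom-E* (x ∸ c) {h = h} (replicate (suc a) N ++ fromBlocks x as xs) (m+[n∸m]≡n c≤x)
          | retFrom-N* a {x} {h} (fromBlocks x as xs) adm
          | sym (+-suc h a)
          | ret-fromBlocks (admissible-weaken (n≤1+n x) rest)
    with h * m <? x * n + n
  ... | yes _ = refl
  ... | no _ = refl

  words-fromBlocks : ∀ {c h as xs} → Admissible c h as xs → h + sum as ≡ n → c ≤ m →
    fromBlocks c as xs ∈ words (m ∸ c) (sum as)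
  words-fromBlocks {c} [] _ _ = words-E*-end (m ∸ c)
  words-fromBlocks {c} {h} bs@(block {a = a} {as} {x} {xs} _ c≤x _ rest) h+Σ≡n c≤m =
    subst (λ e → fromBlocks c (a ∷ as) (x ∷ xs) ∈ words e (a + sum as)) columns
      (words-E* (x ∸ c) {e = m ∸ x} (words-N* a {e = m ∸ x}
        (words-fromBlocks (admissible-weaken (n≤1+n x) rest) (trans (+-assoc h a (sum as)) h+Σ≡n) x≤m)))
    where
    x≤m : x ≤ m
    x≤m = <⇒≤ (column<m bs h+Σ≡n)
    columns : (x ∸ c) + (m ∸ x) ≡ m ∸ c
    columns = trans (sym (+-∸-comm (m ∸ x) c≤x)) (cong (_∸ c) (m+[n∸m]≡n x≤m))

  blockStartsFrom-afterBlock : ∀ {x h as xs} → Admissible (suc x) h as xs →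
    blockStartsFrom x true (fromBlocks x as xs) ≡ blockStartsFrom x false (fromBlocks x as xs)
  blockStartsFrom-afterBlock {x} [] =
    trans (blockStartsFrom-E*-end (m ∸ x)) (sym (blockStartsFrom-E*-end (m ∸ x)))
  blockStartsFrom-afterBlock {x} (block {a = a} {as} {y} {ys} _ x<y _ _) =
    subst (λ k → blockStartsFrom x true (replicate k E ++ w) ≡ blockStartsFrom x false (replicate k E ++ w))
      (sym (+-∸-assoc 1 x<y)) refl
    where w = replicate a N ++ fromBlocks y as ys

  blockStarts-fromBlocks : ∀ {c h as xs} → Admissible c h as xs →
    blockStartsFrom c false (fromBlocks c as xs) ≡ xs
  blockStarts-fromBlocks {c} [] = blockStartsFrom-E*-end (m ∸ c)
  blockStarts-fromBlocks {c} (block {a = suc a} {as} {x} {xs} _ c≤x _ rest) = begin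
    blockStartsFrom c false (replicate (x ∸ c) E ++ replicate (suc a) N ++ fromBlocks x as xs)
      ≡⟨ blockStartsFrom-E* (x ∸ c) _ (m+[n∸m]≡n c≤x) ⟩
    x ∷ blockStartsFrom x true (replicate a N ++ fromBlocks x as xs)
      ≡⟨ cong (x ∷_) (blockStartsFrom-N* a _) ⟩
    x ∷ blockStartsFrom x true (fromBlocks x as xs)
      ≡⟨ cong (x ∷_) (blockStartsFrom-afterBlock rest) ⟩
    x ∷ blockStartsFrom x false (fromBlocks x as xs)
      ≡⟨ cong (x ∷_) (blockStarts-fromBlocks (admissible-weaken (n≤1+n x) rest)) ⟩
    x ∷ xs ∎
    where open ≡-Reasoning

  -- decode-inBlock p i reads the rest p of a path whose current block, in column c and starting at
  -- height h, already has i + 1 north steps.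
  mutual
    decode : ∀ p {c h e k} → aboveFrom m n c h p ≡ true → p ∈ words e k → e + c ≡ m → k + h ≡ n →
      ∃[ xs ] Admissible c h (compAux 0 p) xs × fromBlocks c (compAux 0 p) xs ≡ p
    decode [] {c} {e = e} {k} _ []∈ e+c≡m _ with words-[]⁻ {e} {k} []∈
    ... | refl , refl = [] , [] , cong (λ k → replicate k E) (trans (cong (_∸ c) (sym e+c≡m)) (n∸n≡0 c))
    decode (E ∷ p) {c} {h} {e} {k} above E∷p∈ e+c≡m k+h≡n with words-E∷⁻ {p} {e} {k} E∷p∈
    ... | e′ , refl , p∈ with decode p (aboveFrom-E∷⁻ p above) p∈ (trans (+-suc e′ c) e+c≡m) k+h≡n
    ...   | xs , adm , eq = xs , admissible-weaken (n≤1+n c) adm ,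
      trans (fromBlocks-E∷ adm (subst (c <_) e+c≡m (m<n+m c z<s))) (cong (E ∷_) eq)
    decode (N ∷ p) {c} {h} {e} {k} above N∷p∈ e+c≡m k+h≡n
      with words-N∷⁻ {p} {e} {k} N∷p∈ | aboveFrom-N∷⁻ p above
    ... | k′ , refl , p∈ | adm , above′ =
      decode-inBlock p 0 adm
        (subst (λ h′ → aboveFrom m n c h′ p ≡ true) (+-comm 1 h) above′) p∈ e+c≡m
        (trans (cong (k′ +_) (+-comm h 1)) (trans (+-suc k′ h) k+h≡n))

    decode-inBlock : ∀ p i {c h e k} → c * n ≤ h * m → aboveFrom m n c (h + suc i) p ≡ true →
      p ∈ words e k → e + c ≡ m → k + (h + suc i) ≡ n →
      ∃[ xs ] Admissible c h (compAux (suc i) p) xs ×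
              fromBlocks c (compAux (suc i) p) xs ≡ replicate (suc i) N ++ p
    decode-inBlock [] i {c} {h} {e} {k} adm _ []∈ e+c≡m k+h≡n with words-[]⁻ {e} {k} []∈
    ... | refl , refl = contradiction (*-cancelʳ-≤ n h m {{>-nonZero (<-trans 0<n n<m)}} (begin
      n * m ≡⟨ *-comm n m ⟩
      m * n ≡⟨ cong (_* n) e+c≡m ⟨
      c * n ≤⟨ adm ⟩
      h * m ∎)) (<⇒≱ (≤-trans (m<m+n h z<s) (≤-reflexive k+h≡n)))
      where open ≤-Reasoning
    decode-inBlock (N ∷ p) i {c} {h} {e} {k} adm above N∷p∈ e+c≡m k+h≡n
      with words-N∷⁻ {p} {e} {k} N∷p∈
    ... | k′ , refl , p∈ with decode-inBlock p (suc i) adm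
          (subst (λ h′ → aboveFrom m n c h′ p ≡ true) (sym (+-suc h (suc i))) (proj₂ (aboveFrom-N∷⁻ p above)))
          p∈ e+c≡m (trans (cong (k′ +_) (+-suc h (suc i))) (trans (+-suc k′ (h + suc i)) k+h≡n))
    ...   | xs , adm′ , eq = xs , adm′ , trans eq (replicate-suc-++ (suc i) N p)
    decode-inBlock (E ∷ p) i {c} {h} {e} {k} adm above E∷p∈ e+c≡m k+h≡n
      with words-E∷⁻ {p} {e} {k} E∷p∈
    ... | e′ , refl , p∈ with decode p (aboveFrom-E∷⁻ p above) p∈ (trans (+-suc e′ c) e+c≡m) k+h≡n
    ...   | xs , adm′ , eq = c ∷ xs , block z<s ≤-refl adm adm′ , (begin
      replicate (c ∸ c) E ++ replicate (suc i) N ++ fromBlocks c (compAux 0 p) xs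
        ≡⟨ cong (λ k → replicate k E ++ replicate (suc i) N ++ fromBlocks c (compAux 0 p) xs) (n∸n≡0 c) ⟩
      replicate (suc i) N ++ fromBlocks c (compAux 0 p) xs
        ≡⟨ cong (replicate (suc i) N ++_) (fromBlocks-E∷ adm′ (subst (c <_) e+c≡m (m<n+m c z<s))) ⟩
      replicate (suc i) N ++ E ∷ fromBlocks (suc c) (compAux 0 p) xs
        ≡⟨ cong (λ w → replicate (suc i) N ++ E ∷ w) eq ⟩
      replicate (suc i) N ++ E ∷ p ∎)
      where open ≡-Reasoning

  fromBlocks-blockStarts : ∀ {p} → p ∈ Dyck m n →
    Admissible 0 0 (comp p) (blockStarts p) × fromBlocks 0 (comp p) (blockStarts p) ≡ p
  fromBlocks-blockStarts {p} p∈ with ∈-filter⁻ (λ q → isDyck m n q ≟ᵇ true) {xs = words m n} p∈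
  ... | p∈words , isDyck with decode p isDyck p∈words (+-identityʳ m) (+-identityʳ n)
  ...   | xs , adm , eq =
    subst (λ ys → Admissible 0 0 (comp p) ys × fromBlocks 0 (comp p) ys ≡ p) (sym starts≡xs) (adm , eq)
    where
    starts≡xs : blockStarts p ≡ xs
    starts≡xs = trans (cong blockStarts (sym eq)) (blockStarts-fromBlocks adm)

  fromBlocks-∈-Dyck : ∀ {α xs} → Admissible 0 0 α xs → sum α ≡ n → fromBlocks 0 α xs ∈ Dyck m n
  fromBlocks-∈-Dyck {α} {xs} adm Σ≡n = ∈-filter⁺ (λ q → isDyck m n q ≟ᵇ true)
    (subst (λ k → fromBlocks 0 α xs ∈ words m k) Σ≡n (words-fromBlocks adm Σ≡n z≤n))
    (isDyck-fromBlocks adm Σ≡n z≤n)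

  record BlockCode (α : List ℕ) (k ℓ : ℕ) (xs : List ℕ) : Set where
    field
      admissible : Admissible 0 0 α xs
      run≡ : runLength 0 xs ≡ k
      returns≡ : returnsFrom 0 α xs ≡ ℓ

  module _ {α : List ℕ} (Σα≡n : sum α ≡ n) where

    fromBlocks-∈-Dαkl : ∀ {k ℓ xs} → BlockCode α k ℓ xs → fromBlocks 0 α xs ∈ Dαkl m n α k ℓ
    fromBlocks-∈-Dαkl record { admissible = adm ; run≡ = run≡ ; returns≡ = returns≡ } =
      ∈-Dαkl⁺ (fromBlocks-∈-Dyck adm Σα≡n) (comp-fromBlocks adm Σα≡n)
        (trans (run-fromBlocks adm Σα≡n) run≡) (trans (ret-fromBlocks adm) returns≡)

    blockStarts-∈-Dαkl : ∀ {k ℓ p} → p ∈ Dαkl m n α k ℓ →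
      BlockCode α k ℓ (blockStarts p) × fromBlocks 0 α (blockStarts p) ≡ p
    blockStarts-∈-Dαkl {k} {ℓ} {p} p∈ with ∈-Dαkl⁻ {m} {n} {α} {k} {ℓ} p∈
    ... | p∈Dyck , comp≡ , run≡ , ret≡
      with subst (λ β → Admissible 0 0 β (blockStarts p) × fromBlocks 0 β (blockStarts p) ≡ p)
                 comp≡ (fromBlocks-blockStarts p∈Dyck)
    ...   | adm , eq = record
      { admissible = adm
      ; run≡ = trans (sym (run-fromBlocks adm Σα≡n)) (trans (cong (run n) eq) run≡)
      ; returns≡ = trans (sym (ret-fromBlocks adm)) (trans (cong (ret m n) eq) ret≡)
      } , eq

    length-Dαkl-≡ : ∀ {k ℓ k′ ℓ′} (f g : List ℕ → List ℕ) →
      (∀ {xs} → BlockCode α k ℓ xs → BlockCode α k′ ℓ′ (f xs)) →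
      (∀ {ys} → BlockCode α k′ ℓ′ ys → BlockCode α k ℓ (g ys)) →
      (∀ {xs} → BlockCode α k ℓ xs → g (f xs) ≡ xs) →
      (∀ {ys} → BlockCode α k′ ℓ′ ys → f (g ys) ≡ ys) →
      length (Dαkl m n α k ℓ) ≡ length (Dαkl m n α k′ ℓ′)
    length-Dαkl-≡ {k} {ℓ} {k′} {ℓ′} f g f-code g-code gf fg =
      length-≡-by-inverses (Dαkl-unique {m} {n} {α} {k} {ℓ}) (Dαkl-unique {m} {n} {α} {k′} {ℓ′})
        (onPaths f) (onPaths g)
        (fromBlocks-∈-Dαkl ∘ f-code ∘ proj₁ ∘ blockStarts-∈-Dαkl)
        (fromBlocks-∈-Dαkl ∘ g-code ∘ proj₁ ∘ blockStarts-∈-Dαkl)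
        (round-trip {f = f} {g} f-code gf) (round-trip {f = g} {f} g-code fg)
      where
      onPaths : (List ℕ → List ℕ) → List Step → List Step
      onPaths h = fromBlocks 0 α ∘ h ∘ blockStarts
      round-trip : ∀ {k ℓ k′ ℓ′} {f g : List ℕ → List ℕ} →
        (∀ {xs} → BlockCode α k ℓ xs → BlockCode α k′ ℓ′ (f xs)) →
        (∀ {xs} → BlockCode α k ℓ xs → g (f xs) ≡ xs) →
        ∀ {p} → p ∈ Dαkl m n α k ℓ → onPaths g (onPaths f p) ≡ p
      round-trip {k} {ℓ} {f = f} {g} f-code gf {p} p∈ with blockStarts-∈-Dαkl {k} {ℓ} p∈
      ... | code , eq = begin
        fromBlocks 0 α (g (blockStarts (fromBlocks 0 α (f (blockStarts p)))))
          ≡⟨ cong (fromBlocks 0 α ∘ g) (blockStarts-fromBlocks (BlockCode.admissible (f-code code))) ⟩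
        fromBlocks 0 α (g (f (blockStarts p)))
          ≡⟨ cong (fromBlocks 0 α) (gf code) ⟩
        fromBlocks 0 α (blockStarts p)
          ≡⟨ eq ⟩
        p ∎
        where open ≡-Reasoning

  -- The bijection

  push : ℕ → List ℕ → List ℕ → List ℕ
  push h (a ∷ as) (x ∷ xs) with returns? h x
  ... | yes _ = xs
  ... | no _ = suc x ∷ push (h + a) as xs
  push _ _ _ = []

  pull : ℕ → List ℕ → List ℕ → List ℕ
  pull h (a ∷ as) [] = maxColumn h ∷ []
  pull h (a ∷ as) (w ∷ ws) with w * n ≤? h * m
  ... | yes _ = pred w ∷ pull (h + a) as ws
  ... | no _ = maxColumn h ∷ w ∷ ws
  pull _ [] _ = []

  push-returns : ∀ {h a as x xs} → Returns h x → push h (a ∷ as) (x ∷ xs) ≡ xs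
  push-returns {h} {x = x} ret with returns? h x
  ... | yes _ = refl
  ... | no ¬ret = contradiction ret ¬ret

  push-¬returns : ∀ {h a as x xs} → ¬ Returns h x →
    push h (a ∷ as) (x ∷ xs) ≡ suc x ∷ push (h + a) as xs
  push-¬returns {h} {x = x} ¬ret with returns? h x
  ... | yes ret = contradiction ret ¬ret
  ... | no _ = refl

  pull-admissible : ∀ {h a as w ws} → w * n ≤ h * m →
    pull h (a ∷ as) (w ∷ ws) ≡ pred w ∷ pull (h + a) as ws
  pull-admissible {h} {w = w} adm with w * n ≤? h * m
  ... | yes _ = refl
  ... | no ¬adm = contradiction adm ¬adm

  pull-inadmissible : ∀ {h a as w ws} → ¬ (w * n ≤ h * m) →
    pull h (a ∷ as) (w ∷ ws) ≡ maxColumn h ∷ w ∷ ws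
  pull-inadmissible {h} {w = w} ¬adm with w * n ≤? h * m
  ... | yes adm = contradiction adm ¬adm
  ... | no _ = refl

  pull-returning : ∀ {h a as x xs} → Admissible (suc x) (h + a) as xs → x * n ≤ h * m → Returns h x →
    pull h (a ∷ as) xs ≡ x ∷ xs
  pull-returning {h} {x = x} [] adm ret = cong (_∷ []) (returns⇒maxColumn {x} {h} adm ret)
  pull-returning {h} {x = x} (block {x = y} {ys} _ x<y _ _) adm ret = trans
    (pull-inadmissible {h} {w = y} λ y-adm →
      suc-admissible⇒¬returns {x} {h} (≤-trans (*-monoˡ-≤ n x<y) y-adm) ret)
    (cong (_∷ y ∷ ys) (returns⇒maxColumn {x} {h} adm ret))

  record Shift (lo h a : ℕ) (as xs ys : List ℕ) : Set where
    field
      source : Admissible lo h (a ∷ as) xs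
      target : Admissible (suc lo) (h + a) as ys
      returns : suc (returnsFrom (h + a) as ys) ≡ returnsFrom h (a ∷ as) xs
      push≡ : push h (a ∷ as) xs ≡ ys
      pull≡ : pull h (a ∷ as) ys ≡ xs

  push-shift : ∀ {lo h a as xs} → Admissible lo h (a ∷ as) xs → 0 < returnsFrom h (a ∷ as) xs →
    Shift lo h a as xs (push h (a ∷ as) xs)
  push-shift {lo} {h} {a} src@(block {x = x} {xs} _ lo≤x adm rest) returns>0 with returns? h x
  ... | yes ret = record
    { source = src ; target = admissible-weaken (s≤s lo≤x) rest ; returns = sym (returnsFrom-returns ret)
    ; push≡ = push-returns ret ; pull≡ = pull-returning rest adm ret }
  push-shift (block _ _ _ []) () | no _
  push-shift {lo} {h} {a} src@(block {x = x} {xs} a>0 lo≤x adm rest@(block {a = a′} {as′} a′>0 _ _ _)) returns>0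
    | no ¬ret = record
    { source = src
    ; target = block a′>0 (s≤s lo≤x) (admissible-mono {suc x} (m≤m+n h a) suc-adm) (Shift.target next)
    ; returns = begin
        suc (returnsFrom (h + a) (a′ ∷ as′) (suc x ∷ push (h + a) (a′ ∷ as′) xs))
          ≡⟨ cong suc (returnsFrom-¬returns (admissible⇒¬returns-above {suc x} (m<m+n h a>0) suc-adm)) ⟩
        suc (returnsFrom (h + a + a′) as′ (push (h + a) (a′ ∷ as′) xs))
          ≡⟨ Shift.returns next ⟩
        returnsFrom (h + a) (a′ ∷ as′) xs
          ≡⟨ returnsFrom-¬returns ¬ret ⟨
        returnsFrom h (a ∷ a′ ∷ as′) (x ∷ xs) ∎
    ; push≡ = push-¬returns ¬ret
    ; pull≡ = trans (pull-admissible {h} {a} {a′ ∷ as′} {suc x} suc-adm) (cong (x ∷_) (Shift.pull≡ next))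
    }
    where
    open ≡-Reasoning
    suc-adm : suc x * n ≤ h * m
    suc-adm = ¬returns⇒suc-admissible {x} {h} ¬ret
    next : Shift (suc x) (h + a) a′ as′ xs (push (h + a) (a′ ∷ as′) xs)
    next = push-shift rest returns>0

  pull-shift : ∀ {lo h a as ys} → Admissible (suc lo) (h + a) as ys → 0 < a → lo * n ≤ h * m →
    Shift lo h a as (pull h (a ∷ as) ys) ys
  pull-shift {lo} {h} {a} [] a>0 lo-adm = record
    { source = block a>0 (admissible⇒≤maxColumn {lo} {h} lo-adm) (maxColumn-admissible h) []
    ; target = []
    ; returns = sym (returnsFrom-returns (maxColumn-returns h))
    ; push≡ = push-returns (maxColumn-returns h)
    ; pull≡ = refl
    }
  pull-shift (block {x = zero} _ () _ _) _ _
  pull-shift {lo} {h} {a} tgt@(block {a = a′} {as′} {suc w} {ws} a′>0 lo<w w-adm rest) a>0 lo-adm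
    with suc w * n ≤? h * m
  ... | yes adm = record
    { source = block a>0 (≤-pred lo<w) (≤-trans (*-monoˡ-≤ n (n≤1+n w)) adm) (Shift.source next)
    ; target = tgt
    ; returns = begin
        suc (returnsFrom (h + a) (a′ ∷ as′) (suc w ∷ ws))
          ≡⟨ cong suc (returnsFrom-¬returns (admissible⇒¬returns-above {suc w} (m<m+n h a>0) adm)) ⟩
        suc (returnsFrom (h + a + a′) as′ ws)
          ≡⟨ Shift.returns next ⟩
        returnsFrom (h + a) (a′ ∷ as′) (pull (h + a) (a′ ∷ as′) ws)
          ≡⟨ returnsFrom-¬returns (suc-admissible⇒¬returns {w} adm) ⟨
        returnsFrom h (a ∷ a′ ∷ as′) (w ∷ pull (h + a) (a′ ∷ as′) ws) ∎
    ; push≡ = trans (push-¬returns (suc-admissible⇒¬returns {w} adm)) (cong (suc w ∷_) (Shift.push≡ next))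
    ; pull≡ = pull-admissible adm
    }
    where
    open ≡-Reasoning
    next : Shift (suc w) (h + a) a′ as′ (pull (h + a) (a′ ∷ as′) ws) ws
    next = pull-shift rest a′>0 (admissible-mono {suc w} (m≤m+n h a) adm)
  ... | no ¬adm = record
    { source = block a>0 (admissible⇒≤maxColumn {lo} {h} lo-adm) (maxColumn-admissible h)
                 (block a′>0 (inadmissible⇒maxColumn< {suc w} {h} ¬adm) w-adm rest)
    ; target = tgt
    ; returns = sym (returnsFrom-returns (maxColumn-returns h))
    ; push≡ = push-returns (maxColumn-returns h)
    ; pull≡ = pull-inadmissible ¬adm
    }

  rr≤⇒spacious : ∀ {α i h rest} → All (0 <_) α → Boundary α i h rest → rr m n α ≤ i →
    suc i * n ≤ h * m
  rr≤⇒spacious {α} {i} {h} α>0 b r≤i with ⊓-sel (suc (Iones α)) (ceilDiv n (m ∸ n))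
  ... | inj₁ r≡Iones+1 = *-mono-≤ (boundary-Iones<⇒index<height α>0 b (subst (_≤ i) r≡Iones+1 r≤i)) n≤m
  ... | inj₂ r≡ceil = begin
    n + i * n          ≤⟨ +-monoˡ-≤ (i * n) (ceilDiv≤⇒≤* n d (subst (λ e → ceilDiv n e ≤ i) m∸n≡1+d
                                                                  (subst (_≤ i) r≡ceil r≤i))) ⟩
    i * suc d + i * n  ≡⟨ *-distribˡ-+ i (suc d) n ⟨
    i * (suc d + n)    ≡⟨ cong (i *_) (trans (cong (_+ n) (sym m∸n≡1+d)) (m∸n+n≡m n≤m)) ⟩
    i * m              ≤⟨ *-monoˡ-≤ m (boundary-index≤height α>0 b) ⟩
    h * m              ∎
    where
    open ≤-Reasoning
    d = m ∸ suc n
    m∸n≡1+d : m ∸ n ≡ suc d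
    m∸n≡1+d = +-∸-assoc 1 n<m

  returns⇒index<rr : ∀ {α i h rest} → All (0 <_) α → Boundary α i h rest → Returns h i → i < rr m n α
  returns⇒index<rr α>0 b ret = ≰⇒> λ r≤i → suc-admissible⇒¬returns (rr≤⇒spacious α>0 b r≤i) ret

  raiseFrom : ℕ → ℕ → List ℕ → List ℕ → List ℕ
  raiseFrom i h (a ∷ as) (x ∷ xs) with x ≟ i
  ... | yes _ = suc i ∷ raiseFrom (suc i) (h + a) as xs
  ... | no _ = push h (a ∷ as) (x ∷ xs)
  raiseFrom i h as xs = push h as xs

  lowerFrom : ℕ → ℕ → List ℕ → List ℕ → List ℕ
  lowerFrom i h (a ∷ as) (w ∷ ws) with w ≟ suc i
  ... | yes _ = i ∷ lowerFrom (suc i) (h + a) as ws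
  ... | no _ = pull h (a ∷ as) (w ∷ ws)
  lowerFrom i h as ws = pull h as ws

  raiseFrom-hit : ∀ {i h a as xs} →
    raiseFrom i h (a ∷ as) (i ∷ xs) ≡ suc i ∷ raiseFrom (suc i) (h + a) as xs
  raiseFrom-hit {i} with i ≟ i
  ... | yes _ = refl
  ... | no i≢i = contradiction refl i≢i

  raiseFrom-above : ∀ {i h as xs} → All (suc i ≤_) xs → raiseFrom i h as xs ≡ push h as xs
  raiseFrom-above {as = []} _ = refl
  raiseFrom-above {as = _ ∷ _} [] = refl
  raiseFrom-above {i} {as = _ ∷ _} {x ∷ _} (i<x ∷ _) with x ≟ i
  ... | yes x≡i = contradiction x≡i (>⇒≢ i<x)
  ... | no _ = refl

  lowerFrom-hit : ∀ {i h a as ws} →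
    lowerFrom i h (a ∷ as) (suc i ∷ ws) ≡ i ∷ lowerFrom (suc i) (h + a) as ws
  lowerFrom-hit {i} with suc i ≟ suc i
  ... | yes _ = refl
  ... | no i≢i = contradiction refl i≢i

  lowerFrom-above : ∀ {i h as ws} → All (suc (suc i) ≤_) ws → lowerFrom i h as ws ≡ pull h as ws
  lowerFrom-above {as = []} _ = refl
  lowerFrom-above {as = _ ∷ _} [] = refl
  lowerFrom-above {i} {as = _ ∷ _} {w ∷ _} (i<w ∷ _) with w ≟ suc i
  ... | yes w≡i = contradiction w≡i (>⇒≢ i<w)
  ... | no _ = refl

  record RunShift (i h a : ℕ) (as xs ys : List ℕ) : Set where
    field
      source : Admissible i h (a ∷ as) xs
      target : Admissible (suc i) (h + a) as ys
      runLength≡ : runLength (suc i) ys ≡ runLength i xs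
      returns : suc (returnsFrom h (a ∷ as) (i ∷ ys)) ≡ returnsFrom h (a ∷ as) xs
      raise≡ : raiseFrom i h (a ∷ as) xs ≡ ys
      lower≡ : lowerFrom i h (a ∷ as) ys ≡ xs

  module _ {α : List ℕ} (α>0 : All (0 <_) α) where

    fewer-returns : ∀ {i h a as xs} → Boundary α i h (a ∷ as) →
      rr m n α ∸ i < returnsFrom h (a ∷ as) (i ∷ xs) → rr m n α ∸ suc i < returnsFrom (h + a) as xs
    fewer-returns {i} {h} {a} {as} {xs} b r∸i< with returns? h i
    ... | yes ret =
      ≤-pred (subst (_< suc (returnsFrom (h + a) as xs)) (+-∸-assoc 1 (returns⇒index<rr α>0 b ret)) r∸i<)
    ... | no _ = ≤-<-trans (∸-monoʳ-≤ (rr m n α) (n≤1+n i)) r∸i<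

    raise-shift-above : ∀ {i h a as xs} → Boundary α i h (a ∷ as) → Admissible (suc i) h (a ∷ as) xs →
      rr m n α ≤ i → 0 < returnsFrom h (a ∷ as) xs → RunShift i h a as xs (push h (a ∷ as) xs)
    raise-shift-above {i} {h} {a} {as} {xs} b src r≤i returns>0 = record
      { source = admissible-weaken (n≤1+n i) src
      ; target = admissible-weaken (n≤1+n (suc i)) (Shift.target sh)
      ; runLength≡ = trans (runLength-above (admissible-lowerBound (Shift.target sh)))
          (sym (runLength-above (admissible-lowerBound src)))
      ; returns = trans
          (cong suc (returnsFrom-¬returns (suc-admissible⇒¬returns {i} {h} (rr≤⇒spacious α>0 b r≤i))))
          (Shift.returns sh)
      ; raise≡ = raiseFrom-above {h = h} {a ∷ as} (admissible-lowerBound src)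
      ; lower≡ = trans (lowerFrom-above {h = h} {a ∷ as} (admissible-lowerBound (Shift.target sh)))
                   (Shift.pull≡ sh)
      }
      where
      sh : Shift (suc i) h a as xs (push h (a ∷ as) xs)
      sh = push-shift src returns>0

    raise-shift : ∀ {i h a as xs} → Boundary α i h (a ∷ as) → Admissible i h (a ∷ as) xs →
      rr m n α ≤ i + runLength i xs → rr m n α ∸ i < returnsFrom h (a ∷ as) xs →
      RunShift i h a as xs (raiseFrom i h (a ∷ as) xs)
    raise-shift {i} b (block {x = x} _ _ _ _) r≤ r∸i< with x ≟ i
    raise-shift b (block _ _ _ []) _ r∸i< | yes refl = contradiction (fewer-returns b r∸i<) n≮0
    raise-shift {i} {h} {a} b src@(block {xs = xs} a>0 _ _ rest@(block {a = a′} {as′} a′>0 _ _ _)) r≤ r∸i<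
      | yes refl = record
      { source = src
      ; target = block a′>0 ≤-refl
          (*-mono-≤ (≤-trans (s≤s (boundary-index≤height α>0 b)) (m<m+n h a>0)) n≤m) (RunShift.target next)
      ; runLength≡ = trans (runLength-hit (suc i) _)
          (trans (cong suc (RunShift.runLength≡ next)) (sym (runLength-hit i xs)))
      ; returns = returnsFrom-∷-suc {h} {x = i} (RunShift.returns next)
      ; raise≡ = raiseFrom-hit
      ; lower≡ = trans lowerFrom-hit (cong (i ∷_) (RunShift.lower≡ next))
      }
      where
      next : RunShift (suc i) (h + a) a′ as′ xs (raiseFrom (suc i) (h + a) (a′ ∷ as′) xs)
      next = raise-shift (boundary-step b) rest
        (subst (rr m n α ≤_) (+-suc i _) r≤) (fewer-returns b r∸i<)
    raise-shift {i} b (block a>0 i≤x adm rest) r≤ r∸i< | no x≢i =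
      raise-shift-above b (block a>0 (≤∧≢⇒< i≤x (x≢i ∘ sym)) adm rest) (subst (rr m n α ≤_) (+-identityʳ i) r≤)
        (≤-trans (s≤s z≤n) r∸i<)

    lower-shift-above : ∀ {i h a as ys} → Boundary α i h (a ∷ as) → Admissible (suc i) (h + a) as ys →
      0 < a → All (suc (suc i) ≤_) ys → rr m n α ≤ i → RunShift i h a as (pull h (a ∷ as) ys) ys
    lower-shift-above {i} {h} {a} {as} {ys} b tgt a>0 above r≤i = record
      { source = admissible-weaken (n≤1+n i) (Shift.source sh)
      ; target = tgt
      ; runLength≡ = trans (runLength-above above)
          (sym (runLength-above (admissible-lowerBound (Shift.source sh))))
      ; returns = trans (cong suc (returnsFrom-¬returns (suc-admissible⇒¬returns {i} {h} spacious)))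
                    (Shift.returns sh)
      ; raise≡ = trans (raiseFrom-above {h = h} {a ∷ as} (admissible-lowerBound (Shift.source sh)))
                   (Shift.push≡ sh)
      ; lower≡ = lowerFrom-above {h = h} {a ∷ as} above
      }
      where
      spacious : suc i * n ≤ h * m
      spacious = rr≤⇒spacious α>0 b r≤i
      sh : Shift (suc i) h a as (pull h (a ∷ as) ys) ys
      sh = pull-shift (admissible-withBound above tgt) a>0 spacious

    lower-shift : ∀ {i h a as ys} → Boundary α i h (a ∷ as) → Admissible (suc i) (h + a) as ys → 0 < a →
      rr m n α ≤ i + runLength (suc i) ys → RunShift i h a as (lowerFrom i h (a ∷ as) ys) ys
    lower-shift {i} b [] a>0 r≤ = lower-shift-above b [] a>0 [] (subst (rr m n α ≤_) (+-identityʳ i) r≤)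
    lower-shift {i} b (block {x = w} _ _ _ _) a>0 r≤ with w ≟ suc i
    lower-shift {i} {h} {a} b tgt@(block {a = a′} {as′} {xs = ws} a′>0 _ _ rest) a>0 r≤ | yes refl = record
      { source = block a>0 ≤-refl (*-mono-≤ (boundary-index≤height α>0 b) n≤m) (RunShift.source next)
      ; target = tgt
      ; runLength≡ = trans (runLength-hit (suc i) ws)
          (trans (cong suc (RunShift.runLength≡ next)) (sym (runLength-hit i _)))
      ; returns = returnsFrom-∷-suc {h} {x = i} (RunShift.returns next)
      ; raise≡ = trans raiseFrom-hit (cong (suc i ∷_) (RunShift.raise≡ next))
      ; lower≡ = lowerFrom-hit
      }
      where
      next : RunShift (suc i) (h + a) a′ as′ (lowerFrom (suc i) (h + a) (a′ ∷ as′) ws) ws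
      next = lower-shift (boundary-step b) rest a′>0
        (subst (rr m n α ≤_) (+-suc i _) r≤)
    lower-shift {i} b tgt@(block {x = w} {ws} a′>0 i<w adm rest) a>0 r≤ | no w≢ =
      lower-shift-above b tgt a>0 (admissible-lowerBound (block a′>0 (≤∧≢⇒< i<w (w≢ ∘ sym)) adm rest))
        (subst (rr m n α ≤_) (+-identityʳ i) r≤)

  raise : List ℕ → List ℕ → List ℕ
  raise α xs = 0 ∷ raiseFrom 0 0 α xs

  -- The first block start of a code is always 0, so lower just drops it.
  lower : List ℕ → List ℕ → List ℕ
  lower α [] = []
  lower α (_ ∷ ys) = lowerFrom 0 0 α ys

  raise-code : ∀ {α k ℓ xs} → All (0 <_) α → rr m n α ≤ k → rr m n α ≤ ℓ →
    BlockCode α k (suc ℓ) xs → BlockCode α (suc k) ℓ (raise α xs) × lower α (raise α xs) ≡ xs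
  raise-code _ _ _ record { admissible = [] ; returns≡ = () }
  raise-code {a ∷ as} {k} {ℓ} {xs} α>0@(a>0 ∷ _) r≤k r≤ℓ
    record { admissible = adm ; run≡ = run≡ ; returns≡ = returns≡ } = record
    { admissible = block a>0 z≤n z≤n (RunShift.target sh)
    ; run≡ = trans (runLength-hit 0 (raiseFrom 0 0 (a ∷ as) xs))
        (cong suc (trans (RunShift.runLength≡ sh) run≡))
    ; returns≡ = suc-injective (trans (RunShift.returns sh) returns≡)
    } , RunShift.lower≡ sh
    where
    sh : RunShift 0 0 a as xs (raiseFrom 0 0 (a ∷ as) xs)
    sh = raise-shift α>0 boundary-start adm (subst (rr m n (a ∷ as) ≤_) (sym run≡) r≤k)
      (subst (rr m n (a ∷ as) <_) (sym returns≡) (s≤s r≤ℓ))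

  lower-code : ∀ {α k ℓ ys} → All (0 <_) α → rr m n α ≤ k → BlockCode α (suc k) ℓ ys →
    BlockCode α k (suc ℓ) (lower α ys) × raise α (lower α ys) ≡ ys
  lower-code _ _ record { admissible = [] ; run≡ = () }
  lower-code _ _ record { admissible = block {x = suc y} _ _ y-adm _ } =
    contradiction y-adm (<⇒≱ (≤-trans 0<n (m≤m+n n (y * n))))
  lower-code {a ∷ as} {k} {ℓ} α>0@(a>0 ∷ _) r≤k
    record { admissible = block {x = zero} {ws} _ _ _ rest ; run≡ = run≡ ; returns≡ = returns≡ } =
    record
    { admissible = RunShift.source sh
    ; run≡ = trans (sym (RunShift.runLength≡ sh)) run₁≡
    ; returns≡ = trans (sym (RunShift.returns sh)) (cong suc returns≡)
    } , cong (0 ∷_) (RunShift.raise≡ sh)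
    where
    run₁≡ : runLength 1 ws ≡ k
    run₁≡ = suc-injective (trans (sym (runLength-hit 0 ws)) run≡)
    sh : RunShift 0 0 a as (lowerFrom 0 0 (a ∷ as) ws) ws
    sh = lower-shift α>0 boundary-start rest a>0 (subst (rr m n (a ∷ as) ≤_) (sym run₁≡) r≤k)

  Dαkl-step : ∀ {α k ℓ} → IsComposition n α → rr m n α ≤ k → rr m n α ≤ ℓ →
    length (Dαkl m n α k (suc ℓ)) ≡ length (Dαkl m n α (suc k) ℓ)
  Dαkl-step {α} (α>0 , Σα≡n) r≤k r≤ℓ = length-Dαkl-≡ Σα≡n (raise α) (lower α)
    (proj₁ ∘ raise-code α>0 r≤k r≤ℓ) (proj₁ ∘ lower-code α>0 r≤k)
    (proj₂ ∘ raise-code α>0 r≤k r≤ℓ) (proj₂ ∘ lower-code α>0 r≤k)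

  Dαkl-transfer : ∀ {α} → IsComposition n α → ∀ d {k} → rr m n α ≤ k →
    length (Dαkl m n α k (rr m n α + d)) ≡ length (Dαkl m n α (k + d) (rr m n α))
  Dαkl-transfer {α} _ zero {k} _ =
    cong₂ (λ k ℓ → length (Dαkl m n α k ℓ)) (sym (+-identityʳ k)) (+-identityʳ (rr m n α))
  Dαkl-transfer {α} α-comp (suc d) {k} r≤k = begin
    length (D k (r + suc d))   ≡⟨ cong (length ∘ D k) (+-suc r d) ⟩
    length (D k (suc (r + d))) ≡⟨ Dαkl-step α-comp r≤k (m≤m+n r d) ⟩
    length (D (suc k) (r + d)) ≡⟨ Dαkl-transfer α-comp d (m≤n⇒m≤1+n r≤k) ⟩
    length (D (suc k + d) r)   ≡⟨ cong (λ k → length (D k r)) (+-suc k d) ⟨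
    length (D (k + suc d) r)   ∎
    where
    open ≡-Reasoning
    D = Dαkl m n α
    r = rr m n α

theorem3p2 : (m n : ℕ) → 0 < n → n < m → (α : List ℕ) → IsComposition n α →
    (a b : ℕ) → a ≤ b →
    length (Dαkl m n α (rr m n α + a) (rr m n α + b ∸ a))
      ≡ length (Dαkl m n α (rr m n α + b) (rr m n α))
theorem3p2 m n 0<n n<m α α-comp a b a≤b = begin
  length (D (r + a) (r + b ∸ a))   ≡⟨ cong (length ∘ D (r + a)) (+-∸-assoc r a≤b) ⟩
  length (D (r + a) (r + (b ∸ a))) ≡⟨ Dαkl-transfer α-comp (b ∸ a) (m≤m+n r a) ⟩
  length (D (r + a + (b ∸ a)) r)   ≡⟨ cong (λ k → length (D k r)) (trans (+-assoc r a (b ∸ a))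
                                                                   (cong (r +_) (m+[n∸m]≡n a≤b))) ⟩
  length (D (r + b) r)             ∎
  where
  open ≡-Reasoning
  open RationalPaths m n 0<n n<m
  D = Dαkl m n α
  r = rr m n α
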